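{- Let $G$ be a graph and let $p,q\in\mathbb{N}$ with $p\ge 2$. Let $G'$ be the graph obtained from $G$ by adding new vertices $u_1,\ldots,u_{p-1}$, attaching $p$ new leaves to each vertex $u_i$, and joining each $u_i$ to every vertex of $G$. Then $\sigma_{(p,q)}(G')=F_q(G)+p(p-1)$.
   Context: All graphs are finite, simple and undirected. Vertices are colored white or blue. Spreading color change rule with parameters $p\in\mathbb{N}$, $q\in\mathbb{N}\cup\{\infty\}$: if a white vertex $w$ has at least $p$ blue neighbors, and one of the blue neighbors of $w$ has at most $q$ white neighbors, then $w$ is recolored blue. A set $S$ is a $(p,q)$-spreading set if, when exactly the vertices of $S$ are initially blue, repeated application of this rule eventually makes all vertices blue; $\sigma_{(p,q)}(G)$ is the minimum size of a $(p,q)$-spreading set of $G$. The $q$-forcing rule: if a blue vertex $u$ has at most $q$ white neighbors, then all white neighbors of $u$ become blue; a $q$-forcing set is a set of initially blue vertices from which repeated application of this rule makes all vertices blue, and $F_q(G)$ is the minimum size of a $q$-forcing set. -}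

module Defs where

open import Data.Bool using (Bool; true; false)
open import Data.Nat using (ℕ; _+_; _*_; _∸_; _≤_)
open import Data.Fin using (Fin; splitAt; remQuot; _≟_)
open import Data.Fin.Subset using (Subset; _∩_; _∪_; ∁; ∣_∣; ⁅_⁆; ⊤; _∈_; _∉_)
open import Data.Vec using (tabulate)
open import Data.Sum using (_⊎_; inj₁; inj₂)
open import Data.Product using (_×_; _,_; ∃; Σ)
open import Relation.Nullary.Decidable using (⌊_⌋)
open import Relation.Binary.PropositionalEquality using (_≡_)
open import Relation.Binary.Construct.Closure.ReflexiveTransitive using (Star)

Graph : ℕ → Set
Graph n = Fin n → Fin n → Bool

IsSimpleGraph : ∀ {n} → Graph n → Set
IsSimpleGraph {n} G = (∀ (u v : Fin n) → G u v ≡ G v u) × (∀ (u : Fin n) → G u u ≡ false)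

nbhd : ∀ {n} → Graph n → Fin n → Subset n
nbhd G u = tabulate (G u)

-- number of blue (in B) / white (not in B) neighbours
blueNbrs : ∀ {n} → Graph n → Subset n → Fin n → ℕ
blueNbrs G B w = ∣ nbhd G w ∩ B ∣

whiteNbrs : ∀ {n} → Graph n → Subset n → Fin n → ℕ
whiteNbrs G B u = ∣ nbhd G u ∩ ∁ B ∣

data SpreadStep {n} (p q : ℕ) (G : Graph n) : Subset n → Subset n → Set where
  spread : ∀ (B : Subset n) (w v : Fin n) →
           w ∉ B → p ≤ blueNbrs G B w →
           G w v ≡ true → v ∈ B → whiteNbrs G B v ≤ q →
           SpreadStep p q G B (B ∪ ⁅ w ⁆)

data ForceStep {n} (q : ℕ) (G : Graph n) : Subset n → Subset n → Set where
  force : ∀ (B : Subset n) (u : Fin n) →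
          u ∈ B → whiteNbrs G B u ≤ q →
          ForceStep q G B (B ∪ nbhd G u)

IsSpreadingSet : ∀ {n} → ℕ → ℕ → Graph n → Subset n → Set
IsSpreadingSet p q G S = Star (SpreadStep p q G) S ⊤

IsForcingSet : ∀ {n} → ℕ → Graph n → Subset n → Set
IsForcingSet q G S = Star (ForceStep q G) S ⊤

IsMinimum : ∀ {n} → (Subset n → Set) → ℕ → Set
IsMinimum {n} P k = (Σ (Subset n) λ S → P S × ∣ S ∣ ≡ k) × (∀ (S : Subset n) → P S → k ≤ ∣ S ∣)

-- Vertices of G' : Fin n (old vertices) ⊎ Fin (p-1) (the u_i) ⊎ Fin (p-1) × Fin p (leaves (i,j) of u_i)
ExtV : ℕ → ℕ → Set
ExtV n p = Fin n ⊎ (Fin (p ∸ 1) ⊎ (Fin (p ∸ 1) × Fin p))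

decode : ∀ n p → Fin (n + ((p ∸ 1) + (p ∸ 1) * p)) → ExtV n p
decode n p x with splitAt n x
... | inj₁ a = inj₁ a
... | inj₂ y with splitAt (p ∸ 1) y
...   | inj₁ i = inj₂ (inj₁ i)
...   | inj₂ z = inj₂ (inj₂ (remQuot p z))

extAdj : ∀ {n} p → Graph n → ExtV n p → ExtV n p → Bool
extAdj p G (inj₁ a) (inj₁ b) = G a b
extAdj p G (inj₁ a) (inj₂ (inj₁ i)) = true
extAdj p G (inj₂ (inj₁ i)) (inj₁ a) = true
extAdj p G (inj₂ (inj₁ i)) (inj₂ (inj₂ (j , l))) = ⌊ i ≟ j ⌋
extAdj p G (inj₂ (inj₂ (j , l))) (inj₂ (inj₁ i)) = ⌊ j ≟ i ⌋
extAdj p G _ _ = false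

extend : ∀ {n} (p : ℕ) → Graph n → Graph (n + ((p ∸ 1) + (p ∸ 1) * p))
extend {n} p G x y = extAdj p G (decode n p x) (decode n p y)

-- Every leaf of G' has a single neighbour, so with p ≥ 2 it can never be coloured and lies in
-- every spreading set; with the leaves blue, each u_i has p blue leaf neighbours, one of which has
-- a single white neighbour, so the u_i can be coloured at any time at no cost. Once all u_i are blue,
-- an old vertex c has p blue neighbours in G' exactly when it has a blue neighbour in G, and a blue
-- old vertex has the same white neighbours in G and in G'; so a (p,q)-spreading step of G' at an
-- old vertex is a q-forcing step of G, and conversely. Comparing closures under these steps shows
-- that S ↦ S ∪ {leaves} and S' ↦ S' ∩ V(G) turn q-forcing sets of G into spreading sets of G' and
-- back, with sizes differing by exactly the p(p-1) leaves.
module Submission where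

open import Defs
open import Data.Bool using (Bool; true; false; _∧_; not; if_then_else_)
open import Data.Nat using (ℕ; zero; suc; _+_; _*_; _∸_; _≤_; _<_; z≤n; s≤s)
open import Data.Nat.Properties
  using (≤-trans; ≤-reflexive; ≤-<-trans; <⇒≱; +-mono-≤; +-monoˡ-≤; +-monoʳ-≤;
         +-cancelʳ-≤; +-assoc; m≤n⇒m≤1+n; +-identityʳ; *-comm; m≤m+n; m≤n+m)
open import Data.Fin using (Fin; zero; suc; _↑ˡ_; _↑ʳ_; combine; remQuot; splitAt; join; _≟_)
open import Data.Fin.Properties
  using (all?; ¬∀⟶∃¬; suc-injective; ↑ˡ-injective; splitAt-↑ˡ; splitAt-↑ʳ; join-splitAt; remQuot-combine; combine-remQuot)
open import Data.Fin.Subset using (Subset; _∩_; _∪_; ∁; ∣_∣; ⁅_⁆; ⊤; _∈_; _∉_; _⊆_; _⊂_; _⊃_; Nonempty)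
open import Data.Fin.Subset.Properties
  using (_∈?_; ∈⊤; ⊆⊤; ⊆-antisym; p⊆p∪q; x∈p∪q⁺; x∈p∪q⁻; x∈p∩q⁺; x∈p∩q⁻; x∈⁅x⁆; x∈⁅y⁆⇒x≡y;
         x∈∁p⇒x∉p; x∉p⇒x∈∁p; ∣p∩q∣≤∣p∣; ∣p∩q∣≤∣q∣; p⊆q⇒∣p∣≤∣q∣; ∣⁅x⁆∣≡1; nonempty?)
open import Data.Fin.Subset.Induction using (⊃-wellFounded; Acc; acc)
open import Data.Vec using ([]; _∷_; _++_; lookup; tabulate; replicate)
open import Data.Vec.Properties
  using (lookup∘tabulate; lookup-zipWith; lookup-map; lookup-replicate; lookup-++ˡ; lookup-++ʳ;
         []=⇒lookup; lookup⇒[]=)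
open import Data.Product using (∃; _×_; _,_; proj₁; proj₂)
open import Data.Sum using (inj₁; inj₂; [_,_])
open import Function using (_∘_)
open import Relation.Nullary using (yes; no; contradiction)
open import Relation.Nullary.Decidable using (⌊_⌋; isYes≗does; dec-true)
open import Relation.Binary.PropositionalEquality
  using (_≡_; _≢_; refl; sym; trans; cong; cong₂; subst; _≗_; module ≡-Reasoning)
open import Relation.Binary.Construct.Closure.ReflexiveTransitive using (Star; ε; _◅_)

count : ∀ {N} → (Fin N → Bool) → ℕ
count {zero}  f = 0
count {suc N} f = (if f zero then 1 else 0) + count (f ∘ suc)

∣∣≡count : ∀ {N} (X : Subset N) → ∣ X ∣ ≡ count (lookup X)
∣∣≡count []          = refl
∣∣≡count (true ∷ X)  = cong suc (∣∣≡count X)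
∣∣≡count (false ∷ X) = ∣∣≡count X

count-cong : ∀ {N} {f g : Fin N → Bool} → f ≗ g → count f ≡ count g
count-cong {zero}  f≗g = refl
count-cong {suc N} f≗g = cong₂ (λ b c → (if b then 1 else 0) + c) (f≗g zero) (count-cong (f≗g ∘ suc))

count-allFalse : ∀ {N} {f : Fin N → Bool} → (∀ i → f i ≡ false) → count f ≡ 0
count-allFalse {zero}      all = refl
count-allFalse {suc N} {f} all rewrite all zero = count-allFalse (all ∘ suc)

count-allTrue : ∀ {N} {f : Fin N → Bool} → (∀ i → f i ≡ true) → count f ≡ N
count-allTrue {zero}      all = refl
count-allTrue {suc N} {f} all rewrite all zero = cong suc (count-allTrue (all ∘ suc))

count≤N : ∀ {N} (f : Fin N → Bool) → count f ≤ N
count≤N {zero}  f = z≤n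
count≤N {suc N} f with f zero
... | true  = s≤s (count≤N (f ∘ suc))
... | false = m≤n⇒m≤1+n (count≤N (f ∘ suc))

atMostOneTrue⇒count≤1 : ∀ {N} {f : Fin N → Bool} →
                        (∀ i j → f i ≡ true → f j ≡ true → i ≡ j) → count f ≤ 1
atMostOneTrue⇒count≤1 {zero}      unique = z≤n
atMostOneTrue⇒count≤1 {suc N} {f} unique with f zero in f0
... | true  = ≤-reflexive (cong suc (count-allFalse restFalse))
  where
  restFalse : ∀ i → f (suc i) ≡ false
  restFalse i with f (suc i) in fi
  ... | false = refl
  ... | true  with () ← unique zero (suc i) f0 fi
... | false = atMostOneTrue⇒count≤1 λ i j fi fj → suc-injective (unique (suc i) (suc j) fi fj)

count-+ : ∀ a {b} (f : Fin (a + b) → Bool) → count f ≡ count (f ∘ (_↑ˡ b)) + count (f ∘ (a ↑ʳ_))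
count-+ zero    f = refl
count-+ (suc a) f rewrite count-+ a (f ∘ suc) = sym (+-assoc (if f zero then 1 else 0) _ _)

count-row≤count : ∀ {a b} (f : Fin (a * b) → Bool) (i : Fin a) → count (f ∘ combine i) ≤ count f
count-row≤count {suc a} {b} f zero    rewrite count-+ b {a * b} f = m≤m+n _ _
count-row≤count {suc a} {b} f (suc i) rewrite count-+ b {a * b} f =
  ≤-trans (count-row≤count (f ∘ (b ↑ʳ_)) i) (m≤n+m _ _)

∈⇒1≤∣∣ : ∀ {N} {x : Fin N} {X : Subset N} → x ∈ X → 1 ≤ ∣ X ∣
∈⇒1≤∣∣ {x = x} x∈X =
  subst (_≤ _) (∣⁅x⁆∣≡1 x) (p⊆q⇒∣p∣≤∣q∣ λ y∈⁅x⁆ → subst (_∈ _) (sym (x∈⁅y⁆⇒x≡y x y∈⁅x⁆)) x∈X)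

1≤∣∣⇒Nonempty : ∀ {N} (X : Subset N) → 1 ≤ ∣ X ∣ → Nonempty X
1≤∣∣⇒Nonempty X 1≤∣X∣ with nonempty? X
... | yes ne = ne
... | no ¬ne = contradiction (≤-trans 1≤∣X∣ (≤-reflexive (trans (∣∣≡count X) (count-allFalse notIn)))) λ ()
  where
  notIn : ∀ x → lookup X x ≡ false
  notIn x with lookup X x in eq
  ... | false = refl
  ... | true  = contradiction (x , lookup⇒[]= x X eq) ¬ne

∈nbhd⁺ : ∀ {n} {G : Graph n} {u c} → G u c ≡ true → c ∈ nbhd G u
∈nbhd⁺ {G = G} {u} {c} e = lookup⇒[]= c (nbhd G u) (trans (lookup∘tabulate (G u) c) e)

∈nbhd⁻ : ∀ {n} {G : Graph n} {u c} → c ∈ nbhd G u → G u c ≡ true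
∈nbhd⁻ {G = G} {u} {c} c∈ = trans (sym (lookup∘tabulate (G u) c)) ([]=⇒lookup c∈)

blueNbrs≡count : ∀ {n} (G : Graph n) B w → blueNbrs G B w ≡ count (λ v → G w v ∧ lookup B v)
blueNbrs≡count G B w = trans (∣∣≡count (nbhd G w ∩ B)) (count-cong λ v →
  trans (lookup-zipWith _∧_ v (nbhd G w) B) (cong (_∧ lookup B v) (lookup∘tabulate (G w) v)))

whiteNbrs≡count : ∀ {n} (G : Graph n) B w → whiteNbrs G B w ≡ count (λ v → G w v ∧ not (lookup B v))
whiteNbrs≡count G B w = trans (∣∣≡count (nbhd G w ∩ ∁ B)) (count-cong λ v →
  trans (lookup-zipWith _∧_ v (nbhd G w) (∁ B)) (cong₂ _∧_ (lookup∘tabulate (G w) v) (lookup-map v not B)))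

whiteNbrs-antitone : ∀ {n} (G : Graph n) {D D'} → D ⊆ D' → ∀ b → whiteNbrs G D' b ≤ whiteNbrs G D b
whiteNbrs-antitone G {D} {D'} D⊆D' b = p⊆q⇒∣p∣≤∣q∣ λ x∈ →
  let x∈N , x∈∁D' = x∈p∩q⁻ (nbhd G b) (∁ D') x∈
  in  x∈p∩q⁺ (x∈N , x∉p⇒x∈∁p (x∈∁p⇒x∉p x∈∁D' ∘ D⊆D'))

degree : ∀ {n} → Graph n → Fin n → ℕ
degree G v = ∣ nbhd G v ∣

degree≡count : ∀ {n} (G : Graph n) v → degree G v ≡ count (G v)
degree≡count G v = trans (∣∣≡count (nbhd G v)) (count-cong (lookup∘tabulate (G v)))

strictGrowth⇒⊤ : ∀ {N} {Step : Subset N → Subset N → Set} {S : Subset N} →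
                 (∀ {B x} → S ⊆ B → x ∉ B → ∃ λ C → Step B C × B ⊂ C) → Star Step S ⊤
strictGrowth⇒⊤ {N} {Step} {S} grow = go (⊃-wellFounded S) (λ x∈S → x∈S)
  where
  go : ∀ {B} → Acc _⊃_ B → S ⊆ B → Star Step B ⊤
  go {B} (acc rs) S⊆B with all? (_∈? B)
  ... | yes all∈B = subst (λ X → Star Step X ⊤) (sym (⊆-antisym ⊆⊤ λ {x} _ → all∈B x)) ε
  ... | no ¬all∈B =
    let x , x∉B        = ¬∀⟶∃¬ N (_∈ B) (_∈? B) ¬all∈B
        C , step , B⊂C = grow S⊆B x∉B
    in  step ◅ go (rs B⊂C) (λ x∈S → proj₁ B⊂C (S⊆B x∈S))

spreadStep-⊂ : ∀ {n p q} {G : Graph n} {B w v} → w ∉ B → p ≤ blueNbrs G B w → G w v ≡ true →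
               v ∈ B → whiteNbrs G B v ≤ q → ∃ λ C → SpreadStep p q G B C × B ⊂ C
spreadStep-⊂ {B = B} {w} {v} w∉B pb adj v∈B wv =
  B ∪ ⁅ w ⁆ , spread B w v w∉B pb adj v∈B wv , p⊆p∪q ⁅ w ⁆ , w , x∈p∪q⁺ (inj₂ (x∈⁅x⁆ w)) , w∉B

lowDegree⇒∈spreadingSet : ∀ {n p q} {G : Graph n} {B v} → degree G v < p → IsSpreadingSet p q G B → v ∈ B
lowDegree⇒∈spreadingSet d<p ε = ∈⊤
lowDegree⇒∈spreadingSet {G = G} {v = v} d<p (spread B w _ _ pb _ _ _ ◅ rest)
  with x∈p∪q⁻ B ⁅ w ⁆ (lowDegree⇒∈spreadingSet d<p rest)
... | inj₁ v∈B = v∈B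
... | inj₂ v∈⁅w⁆ with refl ← x∈⁅y⁆⇒x≡y w v∈⁅w⁆ =
  contradiction (≤-trans pb (∣p∩q∣≤∣p∣ (nbhd G v) B)) (<⇒≱ d<p)

HasForcingMove : ∀ {n} → ℕ → Graph n → Subset n → Set
HasForcingMove q G D = ∃ λ b → b ∈ D × whiteNbrs G D b ≤ q × ∃ λ c → G b c ≡ true × c ∉ D

-- A move in D is read off the first force of the chain that colours a vertex outside D.
forcingSet⇒hasForcingMove : ∀ {n q} {G : Graph n} {S D x} →
                            IsForcingSet q G S → S ⊆ D → x ∉ D → HasForcingMove q G D
forcingSet⇒hasForcingMove ε S⊆D x∉D = contradiction (S⊆D ∈⊤) x∉D
forcingSet⇒hasForcingMove {G = G} {D = D} (force S u u∈S wu ◅ rest) S⊆D x∉D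
  with nonempty? (nbhd G u ∩ ∁ D)
... | yes (c , c∈) =
  let c∈N , c∈∁D = x∈p∩q⁻ (nbhd G u) (∁ D) c∈
  in  u , S⊆D u∈S , ≤-trans (whiteNbrs-antitone G S⊆D u) wu , c , ∈nbhd⁻ {G = G} c∈N , x∈∁p⇒x∉p c∈∁D
... | no noWhiteNbr = forcingSet⇒hasForcingMove rest (λ y∈ → [ S⊆D , N⊆D ] (x∈p∪q⁻ S (nbhd G u) y∈)) x∉D
  where
  N⊆D : nbhd G u ⊆ D
  N⊆D {c} c∈N with c ∈? D
  ... | yes c∈D = c∈D
  ... | no c∉D  = contradiction (c , x∈p∩q⁺ (c∈N , x∉p⇒x∈∁p c∉D)) noWhiteNbr

hasForcingMove⇒forcingSet : ∀ {n q} {G : Graph n} {S} →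
                            (∀ {D x} → S ⊆ D → x ∉ D → HasForcingMove q G D) → IsForcingSet q G S
hasForcingMove⇒forcingSet {G = G} move = strictGrowth⇒⊤ λ {D} S⊆D x∉D →
  let b , b∈D , wb , c , bc , c∉D = move S⊆D x∉D
  in  D ∪ nbhd G b , force D b b∈D wb , p⊆p∪q (nbhd G b) , c , x∈p∪q⁺ (inj₂ (∈nbhd⁺ {G = G} bc)) , c∉D

module Extension {n : ℕ} (r : ℕ) (G : Graph n) where

  p L m : ℕ
  p = suc (suc r)
  L = suc r
  m = L + L * p

  G' : Graph (n + m)
  G' = extend p G

  -- hub i is the paper's u_(i+1); its p leaves leaf i j fill one row of a block of L * p vertices.
  old : Fin n → Fin (n + m)
  old a = a ↑ˡ m

  hub : Fin L → Fin (n + m)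
  hub i = n ↑ʳ (i ↑ˡ L * p)

  leafBlock : Fin (L * p) → Fin (n + m)
  leafBlock z = n ↑ʳ (L ↑ʳ z)

  leaf : Fin L → Fin p → Fin (n + m)
  leaf i j = leafBlock (combine i j)

  decode-old : ∀ a → decode n p (old a) ≡ inj₁ a
  decode-old a rewrite splitAt-↑ˡ n a m = refl

  decode-hub : ∀ i → decode n p (hub i) ≡ inj₂ (inj₁ i)
  decode-hub i rewrite splitAt-↑ʳ n m (i ↑ˡ L * p) | splitAt-↑ˡ L i (L * p) = refl

  decode-leafBlock : ∀ z → decode n p (leafBlock z) ≡ inj₂ (inj₂ (remQuot {L} p z))
  decode-leafBlock z rewrite splitAt-↑ʳ n m (L ↑ʳ z) | splitAt-↑ʳ L (L * p) z = refl

  decode-leaf : ∀ i j → decode n p (leaf i j) ≡ inj₂ (inj₂ (i , j))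
  decode-leaf i j = trans (decode-leafBlock (combine i j)) (cong (inj₂ ∘ inj₂) (remQuot-combine i j))

  ∀leaf⇒∀leafBlock : {P : Fin (n + m) → Set} → (∀ i j → P (leaf i j)) → ∀ z → P (leafBlock z)
  ∀leaf⇒∀leafBlock {P} all z = subst (P ∘ leafBlock) (combine-remQuot {L} p z)
    (all (proj₁ (remQuot {L} p z)) (proj₂ (remQuot {L} p z)))

  data View : Fin (n + m) → Set where
    oldᵛ  : ∀ a → View (old a)
    hubᵛ  : ∀ i → View (hub i)
    leafᵛ : ∀ i j → View (leaf i j)

  view : ∀ x → View x
  view x = subst View (join-splitAt n m x) (viewSplit (splitAt n x))
    where
    viewSplit : ∀ s → View (join n m s)
    viewSplit (inj₁ a) = oldᵛ a
    viewSplit (inj₂ y) = subst (View ∘ (n ↑ʳ_)) (join-splitAt L (L * p) y) (viewNew (splitAt L y))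
      where
      viewNew : ∀ t → View (n ↑ʳ join L (L * p) t)
      viewNew (inj₁ i) = hubᵛ i
      viewNew (inj₂ z) = ∀leaf⇒∀leafBlock {View} leafᵛ z

  old-old : ∀ a b → G' (old a) (old b) ≡ G a b
  old-old a b rewrite decode-old a | decode-old b = refl

  old-hub : ∀ a i → G' (old a) (hub i) ≡ true
  old-hub a i rewrite decode-old a | decode-hub i = refl

  hub-old : ∀ i a → G' (hub i) (old a) ≡ true
  hub-old i a rewrite decode-old a | decode-hub i = refl

  old-leafBlock : ∀ a z → G' (old a) (leafBlock z) ≡ false
  old-leafBlock a z rewrite decode-old a | decode-leafBlock z = refl

  hub-leaf : ∀ i i' j → G' (hub i) (leaf i' j) ≡ ⌊ i ≟ i' ⌋
  hub-leaf i i' j rewrite decode-hub i | decode-leaf i' j = refl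

  hub-ownLeaf : ∀ i j → G' (hub i) (leaf i j) ≡ true
  hub-ownLeaf i j = trans (hub-leaf i i j) (trans (isYes≗does (i ≟ i)) (dec-true (i ≟ i) refl))

  old≢hub : ∀ {a i} → old a ≢ hub i
  old≢hub {a} {i} e with () ← trans (sym (decode-old a)) (trans (cong (decode n p) e) (decode-hub i))

  old≢leaf : ∀ {a i j} → old a ≢ leaf i j
  old≢leaf {a} {i} {j} e with () ← trans (sym (decode-old a)) (trans (cong (decode n p) e) (decode-leaf i j))

  leaf-nbr : ∀ i j {y} → G' (leaf i j) y ≡ true → y ≡ hub i
  leaf-nbr i j {y} e with view y
  ... | oldᵛ a rewrite decode-leaf i j | decode-old a with () ← e
  ... | leafᵛ i' j' rewrite decode-leaf i j | decode-leaf i' j' with () ← e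
  ... | hubᵛ i' rewrite decode-leaf i j | decode-hub i' with i ≟ i' | e
  ...   | yes refl | _  = refl
  ...   | no _     | ()

  count-split : (f : Fin (n + m) → Bool) → count f ≡ count (f ∘ old) + (count (f ∘ hub) + count (f ∘ leafBlock))
  count-split f = trans (count-+ n f) (cong (count (f ∘ old) +_) (count-+ L (f ∘ (n ↑ʳ_))))

  restrict : Subset (n + m) → Subset n
  restrict B = tabulate (lookup B ∘ old)

  lookup-restrict : ∀ B a → lookup (restrict B) a ≡ lookup B (old a)
  lookup-restrict B = lookup∘tabulate (lookup B ∘ old)

  ∈restrict⁺ : ∀ {B a} → old a ∈ B → a ∈ restrict B
  ∈restrict⁺ {B} {a} a∈B = lookup⇒[]= a (restrict B) (trans (lookup-restrict B a) ([]=⇒lookup a∈B))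

  ∈restrict⁻ : ∀ {B a} → a ∈ restrict B → old a ∈ B
  ∈restrict⁻ {B} {a} a∈R = lookup⇒[]= (old a) B (trans (sym (lookup-restrict B a)) ([]=⇒lookup a∈R))

  ∣∣-split : ∀ X → ∣ X ∣ ≡ ∣ restrict X ∣ + (count (lookup X ∘ hub) + count (lookup X ∘ leafBlock))
  ∣∣-split X = trans (∣∣≡count X) (trans (count-split (lookup X))
    (cong (_+ (count (lookup X ∘ hub) + count (lookup X ∘ leafBlock)))
          (sym (trans (∣∣≡count (restrict X)) (count-cong (lookup-restrict X))))))

  degree-leaf : ∀ i j → degree G' (leaf i j) ≤ 1
  degree-leaf i j = subst (_≤ 1) (sym (degree≡count G' (leaf i j)))
    (atMostOneTrue⇒count≤1 λ y y' e e' → trans (leaf-nbr i j e) (sym (leaf-nbr i j e')))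

  nbrCount-old : ∀ (P : Fin (n + m) → Bool) b →
                 count (λ y → G' (old b) y ∧ P y) ≡ count (λ a → G b a ∧ P (old a)) + count (P ∘ hub)
  nbrCount-old P b = begin
    count nbr                                                       ≡⟨ count-split nbr ⟩
    count (nbr ∘ old) + (count (nbr ∘ hub) + count (nbr ∘ leafBlock))
      ≡⟨ cong₂ _+_ (count-cong λ a → cong (_∧ P (old a)) (old-old b a))
                   (cong₂ _+_ (count-cong λ i → cong (_∧ P (hub i)) (old-hub b i))
                              (count-allFalse λ z → cong (_∧ P (leafBlock z)) (old-leafBlock b z))) ⟩
    count (λ a → G b a ∧ P (old a)) + (count (P ∘ hub) + 0)
      ≡⟨ cong (count (λ a → G b a ∧ P (old a)) +_) (+-identityʳ _) ⟩
    count (λ a → G b a ∧ P (old a)) + count (P ∘ hub) ∎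
    where
    open ≡-Reasoning
    nbr : Fin (n + m) → Bool
    nbr y = G' (old b) y ∧ P y

  blueNbrs-old : ∀ B b → blueNbrs G' B (old b) ≡ blueNbrs G (restrict B) b + count (lookup B ∘ hub)
  blueNbrs-old B b = trans (blueNbrs≡count G' B (old b)) (trans (nbrCount-old (lookup B) b)
    (cong (_+ _) (sym (trans (blueNbrs≡count G (restrict B) b)
                             (count-cong λ a → cong (G b a ∧_) (lookup-restrict B a))))))

  whiteNbrs-old : ∀ B b → whiteNbrs G' B (old b) ≡ whiteNbrs G (restrict B) b + count (not ∘ lookup B ∘ hub)
  whiteNbrs-old B b = trans (whiteNbrs≡count G' B (old b)) (trans (nbrCount-old (not ∘ lookup B) b)
    (cong (_+ _) (sym (trans (whiteNbrs≡count G (restrict B) b)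
                             (count-cong λ a → cong (λ x → G b a ∧ not x) (lookup-restrict B a))))))

  blueNbrs-hub : ∀ B i → (∀ j → leaf i j ∈ B) → p ≤ blueNbrs G' B (hub i)
  blueNbrs-hub B i leaves∈B = begin
    p                                                     ≡⟨ sym (count-allTrue ownLeafBlue) ⟩
    count (blueNbr ∘ leaf i)                              ≤⟨ count-row≤count {L} {p} (blueNbr ∘ leafBlock) i ⟩
    count (blueNbr ∘ leafBlock)                           ≤⟨ m≤n+m _ (count (blueNbr ∘ hub)) ⟩
    count (blueNbr ∘ hub) + count (blueNbr ∘ leafBlock)   ≤⟨ m≤n+m _ (count (blueNbr ∘ old)) ⟩
    count (blueNbr ∘ old) + (count (blueNbr ∘ hub) + count (blueNbr ∘ leafBlock)) ≡⟨ sym (count-split blueNbr) ⟩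
    count blueNbr                                         ≡⟨ sym (blueNbrs≡count G' B (hub i)) ⟩
    blueNbrs G' B (hub i)                                 ∎
    where
    open Data.Nat.Properties.≤-Reasoning
    blueNbr : Fin (n + m) → Bool
    blueNbr y = G' (hub i) y ∧ lookup B y
    ownLeafBlue : ∀ j → blueNbr (leaf i j) ≡ true
    ownLeafBlue j = cong₂ _∧_ (hub-ownLeaf i j) ([]=⇒lookup (leaves∈B j))

  ∣∁restrict∣≤whiteNbrs-hub : ∀ B i → ∣ ∁ (restrict B) ∣ ≤ whiteNbrs G' B (hub i)
  ∣∁restrict∣≤whiteNbrs-hub B i = begin
    ∣ ∁ (restrict B) ∣                    ≡⟨ ∣∣≡count (∁ (restrict B)) ⟩
    count (lookup (∁ (restrict B)))       ≡⟨ count-cong whiteOld ⟩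
    count (whiteNbr ∘ old)                ≤⟨ m≤m+n _ (count (whiteNbr ∘ hub) + count (whiteNbr ∘ leafBlock)) ⟩
    count (whiteNbr ∘ old) + (count (whiteNbr ∘ hub) + count (whiteNbr ∘ leafBlock)) ≡⟨ sym (count-split whiteNbr) ⟩
    count whiteNbr                        ≡⟨ sym (whiteNbrs≡count G' B (hub i)) ⟩
    whiteNbrs G' B (hub i)                ∎
    where
    open Data.Nat.Properties.≤-Reasoning
    whiteNbr : Fin (n + m) → Bool
    whiteNbr y = G' (hub i) y ∧ not (lookup B y)
    whiteOld : ∀ a → lookup (∁ (restrict B)) a ≡ whiteNbr (old a)
    whiteOld a = trans (lookup-map a not (restrict B)) (cong₂ _∧_ (sym (hub-old i a)) (cong not (lookup-restrict B a)))

  blueNbrs-old≥p : ∀ B {c b} → (∀ i → hub i ∈ B) → G c b ≡ true → b ∈ restrict B → p ≤ blueNbrs G' B (old c)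
  blueNbrs-old≥p B {c} hubs∈B cb b∈R = subst (p ≤_) (sym (blueNbrs-old B c))
    (+-mono-≤ (∈⇒1≤∣∣ (x∈p∩q⁺ (∈nbhd⁺ {G = G} cb , b∈R)))
              (≤-reflexive (sym (count-allTrue ([]=⇒lookup ∘ hubs∈B)))))

  blueNbrs-old≥p⇒blueNbr : ∀ B c → p ≤ blueNbrs G' B (old c) → ∃ λ b → G c b ≡ true × b ∈ restrict B
  blueNbrs-old≥p⇒blueNbr B c pb =
    let b , b∈      = 1≤∣∣⇒Nonempty (nbhd G c ∩ restrict B) blueInG
        b∈N , b∈R  = x∈p∩q⁻ (nbhd G c) (restrict B) b∈
    in  b , ∈nbhd⁻ {G = G} b∈N , b∈R
    where
    -- at most L = p - 1 of the p blue neighbours are hubs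
    blueInG : 1 ≤ blueNbrs G (restrict B) c
    blueInG = +-cancelʳ-≤ L 1 _ (≤-trans (subst (p ≤_) (blueNbrs-old B c) pb)
                                         (+-monoʳ-≤ (blueNbrs G (restrict B) c) (count≤N (lookup B ∘ hub))))

  whiteNbrs-old≤ : ∀ B b → (∀ i → hub i ∈ B) → whiteNbrs G' B (old b) ≤ whiteNbrs G (restrict B) b
  whiteNbrs-old≤ B b hubs∈B = ≤-reflexive (trans (whiteNbrs-old B b)
    (trans (cong (whiteNbrs G (restrict B) b +_) (count-allFalse (cong not ∘ []=⇒lookup ∘ hubs∈B))) (+-identityʳ _)))

  whiteNbrs-restrict≤ : ∀ B b → whiteNbrs G (restrict B) b ≤ whiteNbrs G' B (old b)
  whiteNbrs-restrict≤ B b = subst (whiteNbrs G (restrict B) b ≤_) (sym (whiteNbrs-old B b)) (m≤m+n _ _)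

  restrict-∪⁅⁆-⊆ : ∀ B w {C} → restrict B ⊆ C → (∀ {a} → old a ≡ w → a ∈ C) → restrict (B ∪ ⁅ w ⁆) ⊆ C
  restrict-∪⁅⁆-⊆ B w R⊆C new a∈R with x∈p∪q⁻ B ⁅ w ⁆ (∈restrict⁻ {B ∪ ⁅ w ⁆} a∈R)
  ... | inj₁ a∈B   = R⊆C (∈restrict⁺ a∈B)
  ... | inj₂ a∈⁅w⁆ = new (x∈⁅y⁆⇒x≡y w a∈⁅w⁆)

  lift : Subset n → Subset (n + m)
  lift S = S ++ (replicate L false ++ replicate (L * p) true)

  lookup-lift-old : ∀ S a → lookup (lift S) (old a) ≡ lookup S a
  lookup-lift-old S = lookup-++ˡ S _

  lookup-lift-hub : ∀ S i → lookup (lift S) (hub i) ≡ false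
  lookup-lift-hub S i = trans (lookup-++ʳ S _ (i ↑ˡ L * p))
    (trans (lookup-++ˡ (replicate L false) _ i) (lookup-replicate i false))

  lookup-lift-leafBlock : ∀ S z → lookup (lift S) (leafBlock z) ≡ true
  lookup-lift-leafBlock S z = trans (lookup-++ʳ S _ (L ↑ʳ z))
    (trans (lookup-++ʳ (replicate L false) _ z) (lookup-replicate z true))

  ∣lift∣ : ∀ S → ∣ lift S ∣ ≡ ∣ S ∣ + p * L
  ∣lift∣ S = begin
    ∣ lift S ∣               ≡⟨ ∣∣≡count (lift S) ⟩
    count (lookup (lift S)) ≡⟨ count-split (lookup (lift S)) ⟩
    count (lookup (lift S) ∘ old) + (count (lookup (lift S) ∘ hub) + count (lookup (lift S) ∘ leafBlock))
      ≡⟨ cong₂ _+_ (trans (count-cong (lookup-lift-old S)) (sym (∣∣≡count S)))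
                   (cong₂ _+_ (count-allFalse (lookup-lift-hub S)) (count-allTrue (lookup-lift-leafBlock S))) ⟩
    ∣ S ∣ + L * p             ≡⟨ cong (∣ S ∣ +_) (*-comm L p) ⟩
    ∣ S ∣ + p * L             ∎
    where open ≡-Reasoning

  old∈lift : ∀ {S a} → a ∈ S → old a ∈ lift S
  old∈lift {S} {a} a∈S = lookup⇒[]= (old a) (lift S) (trans (lookup-lift-old S a) ([]=⇒lookup a∈S))

  leaf∈lift : ∀ S i j → leaf i j ∈ lift S
  leaf∈lift S i j = lookup⇒[]= (leaf i j) (lift S) (lookup-lift-leafBlock S (combine i j))

  module _ {q : ℕ} (G-sym : ∀ u v → G u v ≡ G v u) where

    lift-spreadingSet : ∀ {S} → 1 ≤ q → IsForcingSet q G S → IsSpreadingSet p q G' (lift S)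
    lift-spreadingSet {S} 1≤q fs = strictGrowth⇒⊤ grow
      where
      grow : ∀ {B x} → lift S ⊆ B → x ∉ B → ∃ λ C → SpreadStep p q G' B C × B ⊂ C
      grow {B} {x} S'⊆B x∉B with all? (λ i → hub i ∈? B)
      ... | no ¬hubs∈B =
        let i , hub∉B = ¬∀⟶∃¬ L (λ i → hub i ∈ B) (λ i → hub i ∈? B) ¬hubs∈B
        in  spreadStep-⊂ hub∉B (blueNbrs-hub B i (λ j → S'⊆B (leaf∈lift S i j))) (hub-ownLeaf i zero)
              (S'⊆B (leaf∈lift S i zero))
              (≤-trans (∣p∩q∣≤∣p∣ (nbhd G' (leaf i zero)) (∁ B)) (≤-trans (degree-leaf i zero) 1≤q))
      ... | yes hubs∈B with view x
      ...   | hubᵛ i    = contradiction (hubs∈B i) x∉B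
      ...   | leafᵛ i j = contradiction (S'⊆B (leaf∈lift S i j)) x∉B
      ...   | oldᵛ a    =
        let b , b∈R , wb , c , bc , c∉R =
              forcingSet⇒hasForcingMove fs (λ a∈S → ∈restrict⁺ (S'⊆B (old∈lift a∈S))) (x∉B ∘ ∈restrict⁻)
        in  spreadStep-⊂ (c∉R ∘ ∈restrict⁺) (blueNbrs-old≥p B hubs∈B (trans (G-sym c b) bc) b∈R)
              (trans (old-old c b) (trans (G-sym c b) bc)) (∈restrict⁻ b∈R) (≤-trans (whiteNbrs-old≤ B b hubs∈B) wb)

    -- If v is a hub, every white old vertex is a white neighbour of v, so any blue G-neighbour of c can force c.
    oldSpread⇒hasForcingMove : ∀ {B C c v} → restrict B ⊆ C → c ∉ C → p ≤ blueNbrs G' B (old c) →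
                               G' (old c) v ≡ true → v ∈ B → whiteNbrs G' B v ≤ q → HasForcingMove q G C
    oldSpread⇒hasForcingMove {B} {C} {c} {v} R⊆C c∉C pb adj v∈B wv with view v
    ... | oldᵛ b    = b , R⊆C (∈restrict⁺ v∈B) ,
                      ≤-trans (whiteNbrs-antitone G R⊆C b) (≤-trans (whiteNbrs-restrict≤ B b) wv) ,
                      c , trans (G-sym b c) (trans (sym (old-old c b)) adj) , c∉C
    ... | hubᵛ i    =
      let x , cx , x∈R = blueNbrs-old≥p⇒blueNbr B c pb
      in  x , R⊆C x∈R ,
          ≤-trans (whiteNbrs-antitone G R⊆C x)
                  (≤-trans (∣p∩q∣≤∣q∣ (nbhd G x) (∁ (restrict B))) (≤-trans (∣∁restrict∣≤whiteNbrs-hub B i) wv)) ,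
          c , trans (G-sym x c) cx , c∉C
    ... | leafᵛ i j = contradiction (trans (sym adj) (old-leafBlock c (combine i j))) λ ()

    -- The move comes from the first step of the chain that colours an old vertex outside C.
    spreadingSet⇒hasForcingMove : ∀ {B C a} → IsSpreadingSet p q G' B → restrict B ⊆ C → a ∉ C → HasForcingMove q G C
    spreadingSet⇒hasForcingMove ε R⊆C a∉C = contradiction (R⊆C (∈restrict⁺ ∈⊤)) a∉C
    spreadingSet⇒hasForcingMove {C = C} (spread B w v _ pb adj v∈B wv ◅ rest) R⊆C a∉C with view w
    ... | hubᵛ i    = spreadingSet⇒hasForcingMove rest
                        (restrict-∪⁅⁆-⊆ B (hub i) R⊆C (λ e → contradiction e old≢hub)) a∉C
    ... | leafᵛ i j = spreadingSet⇒hasForcingMove rest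
                        (restrict-∪⁅⁆-⊆ B (leaf i j) R⊆C (λ e → contradiction e (old≢leaf {i = i} {j}))) a∉C
    ... | oldᵛ c with c ∈? C
    ...   | yes c∈C = spreadingSet⇒hasForcingMove rest
                        (restrict-∪⁅⁆-⊆ B (old c) R⊆C λ e → subst (_∈ C) (sym (↑ˡ-injective m _ c e)) c∈C) a∉C
    ...   | no c∉C  = oldSpread⇒hasForcingMove R⊆C c∉C pb adj v∈B wv

    restrict-forcingSet : ∀ {S'} → IsSpreadingSet p q G' S' → IsForcingSet q G (restrict S')
    restrict-forcingSet sp = hasForcingMove⇒forcingSet (spreadingSet⇒hasForcingMove sp)

  leaf∈spreadingSet : ∀ {q S'} → IsSpreadingSet p q G' S' → ∀ i j → leaf i j ∈ S'
  leaf∈spreadingSet sp i j = lowDegree⇒∈spreadingSet (≤-<-trans (degree-leaf i j) (s≤s (s≤s z≤n))) sp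

  ∣restrict∣+leaves≤∣∣ : ∀ {q S'} → IsSpreadingSet p q G' S' → ∣ restrict S' ∣ + p * L ≤ ∣ S' ∣
  ∣restrict∣+leaves≤∣∣ {S' = S'} sp = subst (∣ restrict S' ∣ + p * L ≤_) (sym (∣∣-split S'))
    (+-monoʳ-≤ ∣ restrict S' ∣ (≤-trans (≤-reflexive leavesBlue) (m≤n+m _ (count (lookup S' ∘ hub)))))
    where
    leavesBlue : p * L ≡ count (lookup S' ∘ leafBlock)
    leavesBlue = trans (*-comm p L) (sym (count-allTrue
      (∀leaf⇒∀leafBlock {λ x → lookup S' x ≡ true} λ i j → []=⇒lookup (leaf∈spreadingSet sp i j))))

lemma3p3 : (n p q : ℕ) (G : Graph n) → IsSimpleGraph G → 2 ≤ p → 1 ≤ q →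
           (k : ℕ) → IsMinimum (IsForcingSet q G) k →
           IsMinimum (IsSpreadingSet p q (extend p G)) (k + p * (p ∸ 1))
lemma3p3 n (suc zero) q G _ (s≤s ()) _ _ _
lemma3p3 n (suc (suc r)) q G (G-sym , _) _ 1≤q k ((S , S-forcing , ∣S∣≡k) , minimal) =
    (lift S , lift-spreadingSet G-sym 1≤q S-forcing , trans (∣lift∣ S) (cong (_+ p * L) ∣S∣≡k))
  , λ S' S'-spreading → ≤-trans (+-monoˡ-≤ (p * L) (minimal (restrict S') (restrict-forcingSet G-sym S'-spreading)))
                                (∣restrict∣+leaves≤∣∣ S'-spreading)
  where open Extension r G
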